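{- Let $\Sigma$ be a finite set and let $\mathcal{M}_1,\mathcal{M}_2,\mathcal{N}_1,\mathcal{N}_2$ be $L_\Sigma$-structures which are models of $T_{\mathrm{base}(\Sigma)}$. Let $k\in\mathbb{N}$. If $\mathcal{M}_1\approx_k\mathcal{N}_1$ and $\mathcal{M}_2\approx_k\mathcal{N}_2$, then $\mathcal{M}_1\otimes\mathcal{M}_2\approx_k\mathcal{N}_1\otimes\mathcal{N}_2$.
   Context: $L_\Sigma$ is the first-order signature $\{\subseteq,\prec,\mathrm{At},\bot,(P_\sigma)_{\sigma\in\Sigma}\}$ where $\subseteq,\prec$ are binary relation symbols, $\mathrm{At}$ and each $P_\sigma$ are unary relation symbols and $\bot$ is a constant symbol. An atom of a Boolean algebra is a minimal non-bottom element. $T_{\mathrm{base}(\Sigma)}$ is the $L_\Sigma$-theory expressing: (1) $\subseteq$ is the order of an atomic Boolean algebra (every non-bottom element lies above an atom); (2) $\bot$ is its bottom element; (3) $\mathrm{At}$ holds exactly of the atoms, and the atoms are linearly ordered by $\prec$; (4) for all $X,Y$: $X\prec Y$ iff there are atoms $x\subseteq X$, $y\subseteq Y$ with $x\prec y$; (5) the sets $P_\sigma$ ($\sigma\in\Sigma$) partition the set of atoms (each atom lies in exactly one $P_\sigma$; empty parts allowed). For $L_\Sigma$-structures $\mathcal{M},\mathcal{N}$, the $L_\Sigma$-structure $\mathcal{M}\otimes\mathcal{N}$ has universe $\mathcal{M}\times\mathcal{N}$; $(A,B)\subseteq(C,D)$ iff $A\subseteq C$ in $\mathcal{M}$ and $B\subseteq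 D$ in $\mathcal{N}$; $\bot$ is $(\bot^{\mathcal{M}},\bot^{\mathcal{N}})$; $\mathrm{At}$ consists of the elements $(A,\bot)$ with $A\in\mathrm{At}^{\mathcal{M}}$ and $(\bot,B)$ with $B\in\mathrm{At}^{\mathcal{N}}$; $(A,B)\prec(C,D)$ iff ($A\neq\bot$ in $\mathcal{M}$ and $D\neq\bot$ in $\mathcal{N}$) or $\mathcal{M}\models A\prec C$ or $\mathcal{N}\models B\prec D$; $P_\sigma((A,B))$ iff ($\mathcal{M}\models P_\sigma(A)$ and $B=\bot$) or ($A=\bot$ and $\mathcal{N}\models P_\sigma(B)$). For $k\in\mathbb{N}$, $\mathcal{M}\approx_k\mathcal{N}$ means that $\mathcal{M}$ and $\mathcal{N}$ satisfy the same $L_\Sigma$-sentences of quantifier depth at most $k$. -}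

module Defs where

open import Level using (0ℓ)
open import Data.Nat using (ℕ; zero; suc; _≤_; _⊔_)
open import Data.Fin using (Fin)
import Data.Fin as F
open import Data.Product using (Σ; ∃; _×_; _,_)
open import Data.Sum using (_⊎_)
open import Data.Empty using (⊥)
open import Data.Unit using (⊤)
open import Relation.Nullary using (¬_)
open import Relation.Binary.PropositionalEquality using (_≡_)
open import Function.Bundles using (_⇔_)

-- The signature L_Σ, with Σ = Fin s (a finite set of s colours).
-- Relations ⊆, ≺ (binary), At, P σ (unary), constant ⊥ (here `bot`),
-- plus equality (first-order logic with equality).

record Structure (s : ℕ) : Set₁ where
  field
    Carrier : Set
    _⊆_     : Carrier → Carrier → Set
    _≺_     : Carrier → Carrier → Set
    At      : Carrier → Set
    bot     : Carrier
    P       : Fin s → Carrier → Set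

data Term (n : ℕ) : Set where
  var  : Fin n → Term n
  cbot : Term n

data Formula (s : ℕ) : ℕ → Set where
  _≐_   : ∀ {n} → Term n → Term n → Formula s n
  _⊆̇_   : ∀ {n} → Term n → Term n → Formula s n
  _≺̇_   : ∀ {n} → Term n → Term n → Formula s n
  Aṫ    : ∀ {n} → Term n → Formula s n
  Ṗ     : ∀ {n} → Fin s → Term n → Formula s n
  ⊤̇ ⊥̇   : ∀ {n} → Formula s n
  ¬̇_    : ∀ {n} → Formula s n → Formula s n
  _∧̇_ _∨̇_ _⇒̇_ : ∀ {n} → Formula s n → Formula s n → Formula s n
  ∀̇ ∃̇   : ∀ {n} → Formula s (suc n) → Formula s n

Sentence : ℕ → Set
Sentence s = Formula s 0

qd : ∀ {s n} → Formula s n → ℕ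
qd (_ ≐ _)   = 0
qd (_ ⊆̇ _)   = 0
qd (_ ≺̇ _)   = 0
qd (Aṫ _)    = 0
qd (Ṗ _ _)   = 0
qd ⊤̇         = 0
qd ⊥̇         = 0
qd (¬̇ φ)     = qd φ
qd (φ ∧̇ ψ)   = qd φ ⊔ qd ψ
qd (φ ∨̇ ψ)   = qd φ ⊔ qd ψ
qd (φ ⇒̇ ψ)   = qd φ ⊔ qd ψ
qd (∀̇ φ)     = suc (qd φ)
qd (∃̇ φ)     = suc (qd φ)

module _ {s : ℕ} (M : Structure s) where
  open Structure M

  Env : ℕ → Set
  Env n = Fin n → Carrier

  extend : ∀ {n} → Carrier → Env n → Env (suc n)
  extend x ρ F.zero    = x
  extend x ρ (F.suc i) = ρ i

  evalT : ∀ {n} → Env n → Term n → Carrier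
  evalT ρ (var i) = ρ i
  evalT ρ cbot    = bot

  Sat : ∀ {n} → Env n → Formula s n → Set
  Sat ρ (t ≐ u)  = evalT ρ t ≡ evalT ρ u
  Sat ρ (t ⊆̇ u)  = evalT ρ t ⊆ evalT ρ u
  Sat ρ (t ≺̇ u)  = evalT ρ t ≺ evalT ρ u
  Sat ρ (Aṫ t)   = At (evalT ρ t)
  Sat ρ (Ṗ σ t)  = P σ (evalT ρ t)
  Sat ρ ⊤̇        = ⊤
  Sat ρ ⊥̇        = ⊥
  Sat ρ (¬̇ φ)    = ¬ Sat ρ φ
  Sat ρ (φ ∧̇ ψ)  = Sat ρ φ × Sat ρ ψ
  Sat ρ (φ ∨̇ ψ)  = Sat ρ φ ⊎ Sat ρ ψ
  Sat ρ (φ ⇒̇ ψ)  = Sat ρ φ → Sat ρ ψ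
  Sat ρ (∀̇ φ)    = (x : Carrier) → Sat (extend x ρ) φ
  Sat ρ (∃̇ φ)    = Σ Carrier λ x → Sat (extend x ρ) φ

emptyEnv : ∀ {s} (M : Structure s) → Env M 0
emptyEnv M ()

_⊨_ : ∀ {s} → Structure s → Sentence s → Set
M ⊨ φ = Sat M (emptyEnv M) φ

_≈[_]_ : ∀ {s} → Structure s → ℕ → Structure s → Set
M ≈[ k ] N = (φ : Sentence _) → qd φ ≤ k → (M ⊨ φ) ⇔ (N ⊨ φ)

module _ {s : ℕ} (M : Structure s) where
  open Structure M

  IsGlb : Carrier → Carrier → Carrier → Set
  IsGlb x y z = z ⊆ x × z ⊆ y × (∀ w → w ⊆ x → w ⊆ y → w ⊆ z)

  IsLub : Carrier → Carrier → Carrier → Set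
  IsLub x y z = x ⊆ z × y ⊆ z × (∀ w → x ⊆ w → y ⊆ w → z ⊆ w)

  IsAtom : Carrier → Set
  IsAtom a = ¬ (a ≡ bot) × (∀ b → b ⊆ a → (b ≡ bot) ⊎ (b ≡ a))

  record IsBaseModel : Set where
    field
      ⊆-refl    : ∀ x → x ⊆ x
      ⊆-antisym : ∀ x y → x ⊆ y → y ⊆ x → x ≡ y
      ⊆-trans   : ∀ x y z → x ⊆ y → y ⊆ z → x ⊆ z
      meet      : ∀ x y → ∃ λ z → IsGlb x y z
      join      : ∀ x y → ∃ λ z → IsLub x y z
      top       : Carrier
      top-max   : ∀ x → x ⊆ top
      distrib   : ∀ x y z yz m m₁ m₂ → IsLub y z yz → IsGlb x yz m →
                  IsGlb x y m₁ → IsGlb x z m₂ → IsLub m₁ m₂ m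
      complement : ∀ x → ∃ λ y → IsGlb x y bot × IsLub x y top
      atomic    : ∀ x → ¬ (x ≡ bot) → ∃ λ a → IsAtom a × a ⊆ x
      bot-min   : ∀ x → bot ⊆ x
      At⇔atom   : ∀ x → At x ⇔ IsAtom x
      ≺-irrefl  : ∀ a → At a → ¬ (a ≺ a)
      ≺-trans   : ∀ a b c → At a → At b → At c → a ≺ b → b ≺ c → a ≺ c
      ≺-total   : ∀ a b → At a → At b → (a ≺ b) ⊎ (a ≡ b) ⊎ (b ≺ a)
      ≺-lift    : ∀ X Y → (X ≺ Y) ⇔
                  (∃ λ x → ∃ λ y → At x × At y × x ⊆ X × y ⊆ Y × x ≺ y)
      P⇒At      : ∀ σ x → P σ x → At x
      P-cover   : ∀ x → At x → ∃ λ σ → P σ x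
      P-unique  : ∀ σ τ x → P σ x → P τ x → σ ≡ τ

_⊗_ : ∀ {s} → Structure s → Structure s → Structure s
M ⊗ N = record
  { Carrier = M.Carrier × N.Carrier
  ; _⊆_ = λ { (A , B) (C , D) → (A M.⊆ C) × (B N.⊆ D) }
  ; _≺_ = λ { (A , B) (C , D) →
              (¬ (A ≡ M.bot) × ¬ (D ≡ N.bot)) ⊎ (A M.≺ C) ⊎ (B N.≺ D) }
  ; At  = λ { (A , B) → (M.At A × B ≡ N.bot) ⊎ (A ≡ M.bot × N.At B) }
  ; bot = M.bot , N.bot
  ; P   = λ { σ (A , B) → (M.P σ A × B ≡ N.bot) ⊎ (A ≡ M.bot × N.P σ B) }
  }
  where
    module M = Structure M
    module N = Structure N

-- By the Ehrenfeucht–Fraïssé theorem, ≈_k is the existence of a k-round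
-- back-and-forth system; one direction is read off from the depth-k Hintikka
-- formula of a structure (classically, since it records which of the finitely
-- many depth-(k-1) types are realised). In M₁ ⊗ M₂ every atomic formula is a
-- Boolean combination of atomic formulas of the two components, so playing the
-- two component systems side by side is a back-and-forth system for the product.
module Submission where

open import Defs
open import Level using (0ℓ)
open import Data.Nat using (ℕ; zero; suc; _≤_; z≤n; s≤s)
open import Axiom.ExcludedMiddle using (ExcludedMiddle)
open import Data.Nat.Properties using (⊔-lub; m⊔n≤o⇒m≤o; m⊔n≤o⇒n≤o)
open import Data.Fin using (Fin)
import Data.Fin as F
open import Data.List using (List; []; _∷_; map; _++_; cartesianProductWith; filter; allFin)
open import Data.List.Membership.Propositional using (_∈_; lose; find)
open import Data.List.Membership.Propositional.Properties
  using (∈-map⁺; ∈-++⁺ˡ; ∈-++⁺ʳ; ∈-allFin; ∈-cartesianProductWith⁺; ∈-filter⁺)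
open import Data.List.Relation.Unary.All using (All; []; _∷_)
import Data.List.Relation.Unary.All as All
open import Data.List.Relation.Unary.All.Properties using (all-filter)
import Data.List.Relation.Unary.All.Properties as All
open import Data.List.Relation.Unary.Any using (Any; here; there)
open import Data.Product using (∃; _×_; _,_; <_,_>)
open import Data.Product.Properties using (×-≡,≡↔≡)
open import Data.Product.Function.NonDependent.Propositional using (_×-⇔_)
open import Data.Sum using (inj₁; inj₂)
open import Data.Sum.Function.Propositional using (_⊎-⇔_)
open import Data.Unit using (tt)
open import Data.Empty using (⊥-elim)
open import Data.Bool using (true; false)
open import Relation.Nullary using (yes; no; does)
open import Relation.Unary using (Decidable)
open import Relation.Binary.PropositionalEquality using (_≡_; refl; _≗_)
open import Function.Bundles using (_⇔_; mk⇔; Equivalence)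
open import Function.Properties.Inverse using (↔⇒⇔)
open import Function.Related.TypeIsomorphisms using (→-cong-⇔; ¬-cong-⇔)
import Function.Properties.Equivalence as ⇔

open Equivalence using (to; from)

private variable
  s n k : ℕ

Agree : (M : Structure s) → Env M n → (N : Structure s) → Env N n → ℕ → Set
Agree M ρ N σ k = ∀ φ → qd φ ≤ k → Sat M ρ φ ⇔ Sat N σ φ

data Atomic {s} (n : ℕ) : Set where
  _≐ᵃ_ _⊆ᵃ_ _≺ᵃ_ : Term n → Term n → Atomic n
  Atᵃ            : Term n → Atomic n
  Pᵃ             : Fin s → Term n → Atomic n

⌜_⌝ : Atomic {s} n → Formula s n
⌜ t ≐ᵃ u ⌝ = t ≐ u
⌜ t ⊆ᵃ u ⌝ = t ⊆̇ u
⌜ t ≺ᵃ u ⌝ = t ≺̇ u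
⌜ Atᵃ t ⌝  = Aṫ t
⌜ Pᵃ c t ⌝ = Ṗ c t

qd-⌜⌝ : (a : Atomic {s} n) → qd ⌜ a ⌝ ≤ k
qd-⌜⌝ (t ≐ᵃ u) = z≤n
qd-⌜⌝ (t ⊆ᵃ u) = z≤n
qd-⌜⌝ (t ≺ᵃ u) = z≤n
qd-⌜⌝ (Atᵃ t)  = z≤n
qd-⌜⌝ (Pᵃ c t) = z≤n

AtomAgree : (M : Structure s) → Env M n → (N : Structure s) → Env N n → Set
AtomAgree M ρ N σ = ∀ a → Sat M ρ ⌜ a ⌝ ⇔ Sat N σ ⌜ a ⌝

BackForth : (M : Structure s) → Env M n → (N : Structure s) → Env N n → ℕ → Set
BackForth M ρ N σ zero    = AtomAgree M ρ N σ
BackForth M ρ N σ (suc k) = AtomAgree M ρ N σ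
  × (∀ x → ∃ λ y → BackForth M (extend M x ρ) N (extend N y σ) k)
  × (∀ y → ∃ λ x → BackForth M (extend M x ρ) N (extend N y σ) k)

backForth⇒atomAgree : ∀ {M : Structure s} {ρ : Env M n} {N σ} k →
                      BackForth M ρ N σ k → AtomAgree M ρ N σ
backForth⇒atomAgree zero    bf              = bf
backForth⇒atomAgree (suc k) (atoms , _ , _) = atoms

backForth⇒agree : ∀ {M : Structure s} {ρ : Env M n} {N σ} k →
                  BackForth M ρ N σ k → Agree M ρ N σ k
backForth⇒agree k bf (t ≐ u)  _ = backForth⇒atomAgree k bf (t ≐ᵃ u)
backForth⇒agree k bf (t ⊆̇ u)  _ = backForth⇒atomAgree k bf (t ⊆ᵃ u)
backForth⇒agree k bf (t ≺̇ u)  _ = backForth⇒atomAgree k bf (t ≺ᵃ u)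
backForth⇒agree k bf (Aṫ t)   _ = backForth⇒atomAgree k bf (Atᵃ t)
backForth⇒agree k bf (Ṗ c t)  _ = backForth⇒atomAgree k bf (Pᵃ c t)
backForth⇒agree k bf ⊤̇        _ = ⇔.refl
backForth⇒agree k bf ⊥̇        _ = ⇔.refl
backForth⇒agree k bf (¬̇ φ)    q = ¬-cong-⇔ (backForth⇒agree k bf φ q)
backForth⇒agree k bf (φ ∧̇ ψ)  q =
  backForth⇒agree k bf φ (m⊔n≤o⇒m≤o _ _ q) ×-⇔ backForth⇒agree k bf ψ (m⊔n≤o⇒n≤o _ _ q)
backForth⇒agree k bf (φ ∨̇ ψ)  q =
  backForth⇒agree k bf φ (m⊔n≤o⇒m≤o _ _ q) ⊎-⇔ backForth⇒agree k bf ψ (m⊔n≤o⇒n≤o _ _ q)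
backForth⇒agree k bf (φ ⇒̇ ψ)  q =
  →-cong-⇔ (backForth⇒agree k bf φ (m⊔n≤o⇒m≤o _ _ q)) (backForth⇒agree k bf ψ (m⊔n≤o⇒n≤o _ _ q))
backForth⇒agree (suc k) (_ , forth , back) (∀̇ φ) (s≤s q) = mk⇔
  (λ h y → let x , bf = back y  in to   (backForth⇒agree k bf φ q) (h x))
  (λ h x → let y , bf = forth x in from (backForth⇒agree k bf φ q) (h y))
backForth⇒agree (suc k) (_ , forth , back) (∃̇ φ) (s≤s q) = mk⇔
  (λ (x , h) → let y , bf = forth x in y , to   (backForth⇒agree k bf φ q) h)
  (λ (y , h) → let x , bf = back y  in x , from (backForth⇒agree k bf φ q) h)


⋀ ⋁ : List (Formula s n) → Formula s n
⋀ []      = ⊤̇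
⋀ (φ ∷ L) = φ ∧̇ ⋀ L
⋁ []      = ⊥̇
⋁ (φ ∷ L) = φ ∨̇ ⋁ L

module _ (M : Structure s) {ρ : Env M n} where

  Sat-⋀ : ∀ L → Sat M ρ (⋀ L) ⇔ All (Sat M ρ) L
  Sat-⋀ []      = mk⇔ (λ _ → []) (λ _ → tt)
  Sat-⋀ (φ ∷ L) = mk⇔
    (λ (p , ps) → p ∷ to (Sat-⋀ L) ps)
    (λ { (p ∷ ps) → p , from (Sat-⋀ L) ps })

  Sat-⋁ : ∀ L → Sat M ρ (⋁ L) ⇔ Any (Sat M ρ) L
  Sat-⋁ []      = mk⇔ (λ ()) (λ ())
  Sat-⋁ (φ ∷ L) = mk⇔
    (λ { (inj₁ p) → here p ; (inj₂ p) → there (to (Sat-⋁ L) p) })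
    (λ { (here p) → inj₁ p ; (there p) → inj₂ (from (Sat-⋁ L) p) })

qd-⋀ : {L : List (Formula s n)} → All (λ φ → qd φ ≤ k) L → qd (⋀ L) ≤ k
qd-⋀ []       = z≤n
qd-⋀ (q ∷ qs) = ⊔-lub q (qd-⋀ qs)

qd-⋁ : {L : List (Formula s n)} → All (λ φ → qd φ ≤ k) L → qd (⋁ L) ≤ k
qd-⋁ []       = z≤n
qd-⋁ (q ∷ qs) = ⊔-lub q (qd-⋁ qs)

realisesExactly : List (Formula s (suc n)) → Formula s n
realisesExactly S = ⋀ (map ∃̇ S) ∧̇ ∀̇ (⋁ S)

Sat-realisesExactly : ∀ (M : Structure s) {ρ : Env M n} S →
  Sat M ρ (realisesExactly S) ⇔
  (All (λ ψ → ∃ λ x → Sat M (extend M x ρ) ψ) S × (∀ x → Any (Sat M (extend M x ρ)) S))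
Sat-realisesExactly M S = mk⇔
  (λ (h , h′) → All.map⁻ (to (Sat-⋀ M (map ∃̇ S)) h) , λ x → to (Sat-⋁ M S) (h′ x))
  (λ (h , h′) → from (Sat-⋀ M (map ∃̇ S)) (All.map⁺ h) , λ x → from (Sat-⋁ M S) (h′ x))

qd-realisesExactly : {S : List (Formula s (suc n))} →
                     All (λ ψ → qd ψ ≤ k) S → qd (realisesExactly S) ≤ suc k
qd-realisesExactly qs = ⊔-lub (qd-⋀ (All.map⁺ (All.map s≤s qs))) (s≤s (qd-⋁ qs))

terms : ∀ n → List (Term n)
terms n = cbot ∷ map var (allFin n)

∈-terms : (t : Term n) → t ∈ terms n
∈-terms (var i) = there (∈-map⁺ var (∈-allFin i))
∈-terms cbot    = here refl

binaryAtomics : (Term n → Term n → Atomic {s} n) → List (Atomic {s} n)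
binaryAtomics {n} f = cartesianProductWith f (terms n) (terms n)

∈-binaryAtomics : ∀ (f : Term n → Term n → Atomic {s} n) t u → f t u ∈ binaryAtomics f
∈-binaryAtomics f t u = ∈-cartesianProductWith⁺ f (∈-terms t) (∈-terms u)

atomics : ∀ n → List (Atomic {s} n)
atomics {s} n = binaryAtomics _≐ᵃ_ ++ binaryAtomics _⊆ᵃ_ ++ binaryAtomics _≺ᵃ_
             ++ map Atᵃ (terms n) ++ cartesianProductWith Pᵃ (allFin s) (terms n)

∈-atomics : (a : Atomic {s} n) → a ∈ atomics n
∈-atomics (t ≐ᵃ u) = ∈-++⁺ˡ (∈-binaryAtomics _≐ᵃ_ t u)
∈-atomics (t ⊆ᵃ u) = ∈-++⁺ʳ (binaryAtomics _≐ᵃ_) (∈-++⁺ˡ (∈-binaryAtomics _⊆ᵃ_ t u))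
∈-atomics (t ≺ᵃ u) = ∈-++⁺ʳ (binaryAtomics _≐ᵃ_) (∈-++⁺ʳ (binaryAtomics _⊆ᵃ_)
  (∈-++⁺ˡ (∈-binaryAtomics _≺ᵃ_ t u)))
∈-atomics (Atᵃ t)  = ∈-++⁺ʳ (binaryAtomics _≐ᵃ_) (∈-++⁺ʳ (binaryAtomics _⊆ᵃ_)
  (∈-++⁺ʳ (binaryAtomics _≺ᵃ_) (∈-++⁺ˡ (∈-map⁺ Atᵃ (∈-terms t)))))
∈-atomics {n = n} (Pᵃ c t) = ∈-++⁺ʳ (binaryAtomics _≐ᵃ_) (∈-++⁺ʳ (binaryAtomics _⊆ᵃ_)
  (∈-++⁺ʳ (binaryAtomics _≺ᵃ_) (∈-++⁺ʳ (map Atᵃ (terms n))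
  (∈-cartesianProductWith⁺ Pᵃ (∈-allFin c) (∈-terms t)))))

signings : List (Atomic {s} n) → List (List (Formula s n))
signings []      = [] ∷ []
signings (a ∷ L) = map (⌜ a ⌝ ∷_) (signings L) ++ map (¬̇ ⌜ a ⌝ ∷_) (signings L)

sublists : {A : Set} → List A → List (List A)
sublists []      = [] ∷ []
sublists (x ∷ L) = map (x ∷_) (sublists L) ++ sublists L

filter-∈-sublists : {A : Set} {P : A → Set} (P? : Decidable P) (L : List A) →
                    filter P? L ∈ sublists L
filter-∈-sublists P? []      = here refl
filter-∈-sublists P? (x ∷ L) with does (P? x)
... | true  = ∈-++⁺ˡ (∈-map⁺ (x ∷_) (filter-∈-sublists P? L))
... | false = ∈-++⁺ʳ (map (x ∷_) (sublists L)) (filter-∈-sublists P? L)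

module Hintikka (em : ExcludedMiddle 0ℓ) where

  literal : (M : Structure s) → Env M n → Atomic {s} n → Formula s n
  literal M ρ a with em {Sat M ρ ⌜ a ⌝}
  ... | yes _ = ⌜ a ⌝
  ... | no  _ = ¬̇ ⌜ a ⌝

  module _ (M : Structure s) (ρ : Env M n) where

    Sat-literal : ∀ a → Sat M ρ (literal M ρ a)
    Sat-literal a with em {Sat M ρ ⌜ a ⌝}
    ... | yes p = p
    ... | no ¬p = ¬p

    qd-literal : ∀ a → qd (literal M ρ a) ≤ k
    qd-literal a with em {Sat M ρ ⌜ a ⌝}
    ... | yes _ = qd-⌜⌝ a
    ... | no  _ = qd-⌜⌝ a

    literal-agree : ∀ (N : Structure s) {σ : Env N n} a →
                    Sat N σ (literal M ρ a) → Sat M ρ ⌜ a ⌝ ⇔ Sat N σ ⌜ a ⌝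
    literal-agree N a h with em {Sat M ρ ⌜ a ⌝}
    ... | yes p = mk⇔ (λ _ → h) (λ _ → p)
    ... | no ¬p = mk⇔ (λ p → ⊥-elim (¬p p)) (λ q → ⊥-elim (h q))

    map-literal-∈-signings : ∀ L → map (literal M ρ) L ∈ signings L
    map-literal-∈-signings []      = here refl
    map-literal-∈-signings (a ∷ L) with em {Sat M ρ ⌜ a ⌝}
    ... | yes _ = ∈-++⁺ˡ (∈-map⁺ (⌜ a ⌝ ∷_) (map-literal-∈-signings L))
    ... | no  _ = ∈-++⁺ʳ (map (⌜ a ⌝ ∷_) (signings L))
                         (∈-map⁺ (¬̇ ⌜ a ⌝ ∷_) (map-literal-∈-signings L))

    diagram : Formula s n
    diagram = ⋀ (map (literal M ρ) (atomics n))

    Sat-diagram : Sat M ρ diagram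
    Sat-diagram = from (Sat-⋀ M _) (All.map⁺ (All.universal Sat-literal (atomics n)))

    qd-diagram : qd diagram ≤ k
    qd-diagram = qd-⋀ (All.map⁺ (All.universal qd-literal (atomics n)))

    diagram⇒atomAgree : ∀ (N : Structure s) {σ : Env N n} → Sat N σ diagram → AtomAgree M ρ N σ
    diagram⇒atomAgree N h a =
      literal-agree N a (All.lookup (All.map⁻ (to (Sat-⋀ N _) h)) (∈-atomics a))

  diagrams : ∀ n → List (Formula s n)
  diagrams n = map ⋀ (signings (atomics n))

  -- A finite list containing every possible Hintikka formula, so that `realised` is finite.
  hintikkas : ℕ → ∀ n → List (Formula s n)
  hintikkas zero    n = diagrams n
  hintikkas (suc k) n = cartesianProductWith (λ δ S → δ ∧̇ realisesExactly S)
                          (diagrams n) (sublists (hintikkas k (suc n)))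

  mutual
    hintikka : (M : Structure s) → ℕ → Env M n → Formula s n
    hintikka M zero    ρ = diagram M ρ
    hintikka M (suc k) ρ = diagram M ρ ∧̇ realisesExactly (realised M k ρ)

    Realises : (M : Structure s) → ℕ → Env M n → Formula s (suc n) → Set
    Realises M k ρ ψ = ∃ λ x → hintikka M k (extend M x ρ) ≡ ψ

    realised : (M : Structure s) → ℕ → Env M n → List (Formula s (suc n))
    realised M k ρ = filter (λ ψ → em {Realises M k ρ ψ}) (hintikkas k _)

  module _ (M : Structure s) where

    all-realised : ∀ k (ρ : Env M n) → All (Realises M k ρ) (realised M k ρ)
    all-realised k ρ = all-filter (λ _ → em) (hintikkas k _)

    hintikka-∈-hintikkas : ∀ k (ρ : Env M n) → hintikka M k ρ ∈ hintikkas k n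
    hintikka-∈-hintikkas zero    ρ = ∈-map⁺ ⋀ (map-literal-∈-signings M ρ (atomics _))
    hintikka-∈-hintikkas (suc k) ρ = ∈-cartesianProductWith⁺ (λ δ S → δ ∧̇ realisesExactly S)
      (hintikka-∈-hintikkas zero ρ) (filter-∈-sublists (λ _ → em) (hintikkas k _))

    hintikka-∈-realised : ∀ k (ρ : Env M n) x → hintikka M k (extend M x ρ) ∈ realised M k ρ
    hintikka-∈-realised k ρ x =
      ∈-filter⁺ (λ _ → em) (hintikka-∈-hintikkas k (extend M x ρ)) (x , refl)

    qd-hintikka : ∀ k (ρ : Env M n) → qd (hintikka M k ρ) ≤ k
    qd-hintikka zero    ρ = qd-diagram M ρ
    qd-hintikka (suc k) ρ = ⊔-lub (qd-diagram M ρ) (qd-realisesExactly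
      (All.map (λ { (x , refl) → qd-hintikka k (extend M x ρ) }) (all-realised k ρ)))

    Sat-hintikka : ∀ k (ρ : Env M n) → Sat M ρ (hintikka M k ρ)
    Sat-hintikka zero    ρ = Sat-diagram M ρ
    Sat-hintikka (suc k) ρ = Sat-diagram M ρ , from (Sat-realisesExactly M (realised M k ρ))
      ( All.map (λ { (x , refl) → x , Sat-hintikka k (extend M x ρ) }) (all-realised k ρ)
      , λ x → lose (hintikka-∈-realised k ρ x) (Sat-hintikka k (extend M x ρ)))

  hintikka⇒backForth : ∀ (M N : Structure s) k {ρ : Env M n} {σ : Env N n} →
                       Sat N σ (hintikka M k ρ) → BackForth M ρ N σ k
  hintikka⇒backForth M N zero    {ρ} h = diagram⇒atomAgree M ρ N h
  hintikka⇒backForth M N (suc k) {ρ} (h , h′)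
    with to (Sat-realisesExactly N (realised M k ρ)) h′
  ... | realisedInN , coveredInN = diagram⇒atomAgree M ρ N h , forth , back
    where
    forth : ∀ x → ∃ λ y → BackForth M (extend M x ρ) N (extend N y _) k
    forth x = let y , hy = All.lookup realisedInN (hintikka-∈-realised M k ρ x)
              in y , hintikka⇒backForth M N k hy

    back : ∀ y → ∃ λ x → BackForth M (extend M x ρ) N (extend N y _) k
    back y with find (coveredInN y)
    ... | ψ , ψ∈ , hy with All.lookup (all-realised M k ρ) ψ∈
    ... | x , refl = x , hintikka⇒backForth M N k hy

  agree⇒backForth : ∀ {M N : Structure s} {ρ : Env M n} {σ : Env N n} k →
                    Agree M ρ N σ k → BackForth M ρ N σ k
  agree⇒backForth {M = M} {N} {ρ} k M≈N = hintikka⇒backForth M N k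
    (to (M≈N (hintikka M k ρ) (qd-hintikka M k ρ)) (Sat-hintikka M k ρ))

module _ (C₁ C₂ : Structure s) {ρ : Env (C₁ ⊗ C₂) n} {ρ₁ ρ₂} (e : ρ ≗ < ρ₁ , ρ₂ >) where

  evalT-⊗ : ∀ t → evalT (C₁ ⊗ C₂) ρ t ≡ (evalT C₁ ρ₁ t , evalT C₂ ρ₂ t)
  evalT-⊗ (var i) = e i
  evalT-⊗ cbot    = refl

  extend-⊗ : ∀ x₁ x₂ → extend (C₁ ⊗ C₂) (x₁ , x₂) ρ ≗ < extend C₁ x₁ ρ₁ , extend C₂ x₂ ρ₂ >
  extend-⊗ x₁ x₂ F.zero    = refl
  extend-⊗ x₁ x₂ (F.suc i) = e i

module _ {A₁ A₂ B₁ B₂ : Structure s} where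

  -- ≺ of the product refers to "A ≠ ⊥", which is a negated atomic formula thanks to the constant ⊥.
  atomAgree-⊗ : ∀ {ρ : Env (A₁ ⊗ A₂) n} {ρ₁ ρ₂} {σ : Env (B₁ ⊗ B₂) n} {σ₁ σ₂} →
    ρ ≗ < ρ₁ , ρ₂ > → σ ≗ < σ₁ , σ₂ > →
    AtomAgree A₁ ρ₁ B₁ σ₁ → AtomAgree A₂ ρ₂ B₂ σ₂ → AtomAgree (A₁ ⊗ A₂) ρ (B₁ ⊗ B₂) σ
  atomAgree-⊗ e f h₁ h₂ (t ≐ᵃ u)
    rewrite evalT-⊗ A₁ A₂ e t | evalT-⊗ A₁ A₂ e u | evalT-⊗ B₁ B₂ f t | evalT-⊗ B₁ B₂ f u =
      ⇔.trans (⇔.sym (↔⇒⇔ ×-≡,≡↔≡)) (⇔.trans (h₁ (t ≐ᵃ u) ×-⇔ h₂ (t ≐ᵃ u)) (↔⇒⇔ ×-≡,≡↔≡))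
  atomAgree-⊗ e f h₁ h₂ (t ⊆ᵃ u)
    rewrite evalT-⊗ A₁ A₂ e t | evalT-⊗ A₁ A₂ e u | evalT-⊗ B₁ B₂ f t | evalT-⊗ B₁ B₂ f u =
      h₁ (t ⊆ᵃ u) ×-⇔ h₂ (t ⊆ᵃ u)
  atomAgree-⊗ e f h₁ h₂ (t ≺ᵃ u)
    rewrite evalT-⊗ A₁ A₂ e t | evalT-⊗ A₁ A₂ e u | evalT-⊗ B₁ B₂ f t | evalT-⊗ B₁ B₂ f u =
      (¬-cong-⇔ (h₁ (t ≐ᵃ cbot)) ×-⇔ ¬-cong-⇔ (h₂ (u ≐ᵃ cbot))) ⊎-⇔ (h₁ (t ≺ᵃ u) ⊎-⇔ h₂ (t ≺ᵃ u))
  atomAgree-⊗ e f h₁ h₂ (Atᵃ t) rewrite evalT-⊗ A₁ A₂ e t | evalT-⊗ B₁ B₂ f t =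
    (h₁ (Atᵃ t) ×-⇔ h₂ (t ≐ᵃ cbot)) ⊎-⇔ (h₁ (t ≐ᵃ cbot) ×-⇔ h₂ (Atᵃ t))
  atomAgree-⊗ e f h₁ h₂ (Pᵃ c t) rewrite evalT-⊗ A₁ A₂ e t | evalT-⊗ B₁ B₂ f t =
    (h₁ (Pᵃ c t) ×-⇔ h₂ (t ≐ᵃ cbot)) ⊎-⇔ (h₁ (t ≐ᵃ cbot) ×-⇔ h₂ (Pᵃ c t))

  backForth-⊗ : ∀ {ρ : Env (A₁ ⊗ A₂) n} {ρ₁ ρ₂} {σ : Env (B₁ ⊗ B₂) n} {σ₁ σ₂} k →
    ρ ≗ < ρ₁ , ρ₂ > → σ ≗ < σ₁ , σ₂ > →
    BackForth A₁ ρ₁ B₁ σ₁ k → BackForth A₂ ρ₂ B₂ σ₂ k → BackForth (A₁ ⊗ A₂) ρ (B₁ ⊗ B₂) σ k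
  backForth-⊗ zero e f bf₁ bf₂ = atomAgree-⊗ e f bf₁ bf₂
  backForth-⊗ (suc k) e f (atoms₁ , forth₁ , back₁) (atoms₂ , forth₂ , back₂) =
    atomAgree-⊗ e f atoms₁ atoms₂ , forth , back
    where
    forth : ∀ x → ∃ λ y → BackForth (A₁ ⊗ A₂) (extend _ x _) (B₁ ⊗ B₂) (extend _ y _) k
    forth (x₁ , x₂) =
      let y₁ , bf₁ = forth₁ x₁
          y₂ , bf₂ = forth₂ x₂
      in (y₁ , y₂) , backForth-⊗ k (extend-⊗ A₁ A₂ e x₁ x₂) (extend-⊗ B₁ B₂ f y₁ y₂) bf₁ bf₂

    back : ∀ y → ∃ λ x → BackForth (A₁ ⊗ A₂) (extend _ x _) (B₁ ⊗ B₂) (extend _ y _) k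
    back (y₁ , y₂) =
      let x₁ , bf₁ = back₁ y₁
          x₂ , bf₂ = back₂ y₂
      in (x₁ , x₂) , backForth-⊗ k (extend-⊗ A₁ A₂ e x₁ x₂) (extend-⊗ B₁ B₂ f y₁ y₂) bf₁ bf₂

proposition3p10 : ExcludedMiddle 0ℓ →
    {s : ℕ} (M₁ M₂ N₁ N₂ : Structure s) →
    IsBaseModel M₁ → IsBaseModel M₂ → IsBaseModel N₁ → IsBaseModel N₂ →
    (k : ℕ) → M₁ ≈[ k ] N₁ → M₂ ≈[ k ] N₂ →
    (M₁ ⊗ M₂) ≈[ k ] (N₁ ⊗ N₂)
proposition3p10 em M₁ M₂ N₁ N₂ _ _ _ _ k M₁≈N₁ M₂≈N₂ =
  backForth⇒agree k
    (backForth-⊗ k (λ ()) (λ ()) (agree⇒backForth k M₁≈N₁) (agree⇒backForth k M₂≈N₂))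
  where open Hintikka em
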